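{- Let $m\ge1$ and let $H_m$ be the group of all matrices $M\in\operatorname{GL}(2m,2)$ such that $M(Q_m)=Q_m$ and $M(S_m)=S_m$. Let $A\in\operatorname{GL}(m,2)$ and let $S$ be a symmetric $m\times m$ matrix over $\mathbb{F}_2$ with zero diagonal. Then the block matrix $\begin{pmatrix} A & AS\\ O & (A^T)^{ -1}\end{pmatrix}$ (with $O$ the zero matrix) is an element of $H_m$. Moreover, every element of $H_m$ is obtained in this way.
   Context: Vectors of $\mathbb{F}_2^{2m}$ are written $\bar v=\binom{\bar v_1}{\bar v_2}$ with $\bar v_1,\bar v_2\in\mathbb{F}_2^m$. $Q_m=\{\bar v\mid \bar v_1^T\bar v_2=0\}$ and $S_m=\{\bar v\mid\bar v_2=\bar 0\}$. -}

module Defs where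

open import Data.Bool using (Bool; true; false; _xor_; _∧_)
open import Data.Nat using (ℕ; zero; suc; _+_)
open import Data.Fin using (Fin; zero; suc; _↑ˡ_; _↑ʳ_; splitAt; _≟_)
open import Data.Sum using (inj₁; inj₂)
open import Data.Product using (Σ; ∃; _×_)
open import Relation.Nullary.Decidable using (⌊_⌋)
open import Relation.Binary.PropositionalEquality using (_≡_)
open import Function.Bundles using (_⇔_)

-- The field 𝔽₂ is Bool with addition _xor_ and multiplication _∧_.

Vector : ℕ → Set
Vector n = Fin n → Bool

Matrix : ℕ → ℕ → Set
Matrix r c = Fin r → Fin c → Bool

sumF : (n : ℕ) → (Fin n → Bool) → Bool
sumF zero    f = false
sumF (suc n) f = f zero xor sumF n (λ i → f (suc i))

dot : {n : ℕ} → Vector n → Vector n → Bool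
dot {n} u v = sumF n (λ i → u i ∧ v i)

_*M_ : {a b c : ℕ} → Matrix a b → Matrix b c → Matrix a c
_*M_ {b = b} A B i k = sumF b (λ j → A i j ∧ B j k)

apply : {r c : ℕ} → Matrix r c → Vector c → Vector r
apply {c = c} M v i = sumF c (λ j → M i j ∧ v j)

transpose : {r c : ℕ} → Matrix r c → Matrix c r
transpose M i j = M j i

idM : (n : ℕ) → Matrix n n
idM n i j = ⌊ i ≟ j ⌋

zeroM : {r c : ℕ} → Matrix r c
zeroM i j = false

_≈M_ : {r c : ℕ} → Matrix r c → Matrix r c → Set
A ≈M B = ∀ i j → A i j ≡ B i j

_≈V_ : {n : ℕ} → Vector n → Vector n → Set
u ≈V v = ∀ i → u i ≡ v i

IsInverse : {n : ℕ} → Matrix n n → Matrix n n → Set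
IsInverse {n} M N = ((M *M N) ≈M idM n) × ((N *M M) ≈M idM n)

Invertible : {n : ℕ} → Matrix n n → Set
Invertible M = ∃ λ N → IsInverse M N

Symmetric : {n : ℕ} → Matrix n n → Set
Symmetric S = ∀ i j → S i j ≡ S j i

ZeroDiag : {n : ℕ} → Matrix n n → Set
ZeroDiag S = ∀ i → S i i ≡ false

-- A vector of 𝔽₂^{2m} written as (v₁ ; v₂).
top : {m : ℕ} → Vector (m + m) → Vector m
top {m} v i = v (i ↑ˡ m)

bot : {m : ℕ} → Vector (m + m) → Vector m
bot {m} v i = v (m ↑ʳ i)

Qm : (m : ℕ) → Vector (m + m) → Set
Qm m v = dot (top {m} v) (bot {m} v) ≡ false

Sm : (m : ℕ) → Vector (m + m) → Set
Sm m v = ∀ i → bot {m} v i ≡ false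

Image : {n : ℕ} → Matrix n n → (Vector n → Set) → Vector n → Set
Image M P w = ∃ λ v → P v × (apply M v ≈V w)

Preserves : {n : ℕ} → Matrix n n → (Vector n → Set) → Set
Preserves M P = ∀ w → Image M P w ⇔ P w

Hm : (m : ℕ) → Matrix (m + m) (m + m) → Set
Hm m M = Invertible M × Preserves M (Qm m) × Preserves M (Sm m)

block : {m : ℕ} → Matrix m m → Matrix m m → Matrix m m → Matrix m m
      → Matrix (m + m) (m + m)
block {m} A B C D i j with splitAt m i | splitAt m j
... | inj₁ i′ | inj₁ j′ = A i′ j′
... | inj₁ i′ | inj₂ j′ = B i′ j′
... | inj₂ i′ | inj₁ j′ = C i′ j′
... | inj₂ i′ | inj₂ j′ = D i′ j′

-- With  q(v) = v₁·v₂  (so Q_m is the zero set of q), the block matrix acts by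
-- v ↦ (A(v₁ + Sv₂), Dv₂); it has an explicit inverse and preserves q because
-- Sv₂·v₂ = 0.  Conversely, for M ∈ H_m: preserving S_m kills the lower-left
-- block C and makes the upper-left block A surjective; preserving q gives
-- (Ax + By)·Dy = x·y, hence AᵀD = I and By·Dy = 0; then A⁻¹ = Dᵀ, and
-- S = DᵀB is alternating with AS = B.
module Submission where

open import Defs
open import Data.Nat using (ℕ; zero; suc; _≤_; _+_)
open import Data.Product using (Σ; ∃; _×_; _,_; proj₁; proj₂)
open import Data.Bool using (Bool; true; false; _xor_; _∧_)
open import Data.Bool.Properties
  using (xor-assoc; xor-same; xor-identityʳ; ∧-comm; ∧-assoc; ∧-zeroʳ; ∧-identityʳ;
         ∧-distribˡ-xor; ∧-distribʳ-xor; xor-∧-commutativeRing)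
open import Algebra.Bundles using (CommutativeRing)
open import Algebra.Properties.CommutativeSemigroup
  (CommutativeRing.+-commutativeSemigroup xor-∧-commutativeRing) using (interchange)
open import Data.Fin using (Fin; zero; suc; _↑ˡ_; _↑ʳ_; splitAt; _≟_)
open import Data.Fin.Properties using (splitAt-↑ˡ; splitAt-↑ʳ; splitAt⁻¹-↑ˡ; splitAt⁻¹-↑ʳ)
open import Data.Vec.Functional using (_++_)
open import Data.Vec.Functional.Properties using (lookup-++ˡ; lookup-++ʳ)
open import Data.Sum using (inj₁; inj₂)
open import Data.Empty using (⊥-elim)
open import Relation.Nullary.Decidable using (⌊_⌋; yes; no)
open import Relation.Binary.PropositionalEquality
  using (_≡_; refl; sym; trans; cong; cong₂; subst; module ≡-Reasoning)
open import Function.Bundles using (_⇔_; mk⇔; Equivalence)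
open ≡-Reasoning

xor-cancelʳ : ∀ a b → (a xor b) xor b ≡ a
xor-cancelʳ a b = begin
  (a xor b) xor b  ≡⟨ xor-assoc a b b ⟩
  a xor (b xor b)  ≡⟨ cong (a xor_) (xor-same b) ⟩
  a xor false      ≡⟨ xor-identityʳ a ⟩
  a                ∎

xor-false⇒≡ : ∀ {a b} → a xor b ≡ false → a ≡ b
xor-false⇒≡ {a} {b} a+b≡0 = trans (sym (xor-cancelʳ a b)) (cong (_xor b) a+b≡0)

≡false-ext : ∀ {a b : Bool} → (a ≡ false → b ≡ false) → (b ≡ false → a ≡ false) → a ≡ b
≡false-ext {false} {false} _ _ = refl
≡false-ext {false} {true}  f _ = sym (f refl)
≡false-ext {true}  {false} _ g = g refl
≡false-ext {true}  {true}  _ _ = refl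

∧-swap-outer : ∀ a s b → a ∧ (s ∧ b) ≡ b ∧ (s ∧ a)
∧-swap-outer true  s true  = refl
∧-swap-outer true  s false = ∧-zeroʳ s
∧-swap-outer false s true  = sym (∧-zeroʳ s)
∧-swap-outer false s false = refl

≟-suc : ∀ {n} (j k : Fin n) → ⌊ suc j ≟ suc k ⌋ ≡ ⌊ j ≟ k ⌋
≟-suc j k with j ≟ k
... | yes _ = refl
... | no _  = refl

≟-sym : ∀ {n} (j k : Fin n) → ⌊ j ≟ k ⌋ ≡ ⌊ k ≟ j ⌋
≟-sym j k with j ≟ k | k ≟ j
... | yes _   | yes _   = refl
... | no _    | no _    = refl
... | yes j≡k | no k≢j  = ⊥-elim (k≢j (sym j≡k))
... | no j≢k  | yes k≡j = ⊥-elim (j≢k (sym k≡j))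

sumF-cong : ∀ n {f g : Fin n → Bool} → (∀ i → f i ≡ g i) → sumF n f ≡ sumF n g
sumF-cong zero    f≗g = refl
sumF-cong (suc n) f≗g = cong₂ _xor_ (f≗g zero) (sumF-cong n (λ i → f≗g (suc i)))

sumF-zero : ∀ n → sumF n (λ _ → false) ≡ false
sumF-zero zero    = refl
sumF-zero (suc n) = sumF-zero n

sumF-xor : ∀ n (f g : Fin n → Bool) → sumF n (λ i → f i xor g i) ≡ sumF n f xor sumF n g
sumF-xor zero    f g = refl
sumF-xor (suc n) f g =
  trans (cong ((f zero xor g zero) xor_) (sumF-xor n (λ i → f (suc i)) (λ i → g (suc i))))
        (interchange (f zero) (g zero) _ _)

sumF-∧ˡ : ∀ n b (f : Fin n → Bool) → sumF n (λ i → b ∧ f i) ≡ b ∧ sumF n f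
sumF-∧ˡ zero    b f = sym (∧-zeroʳ b)
sumF-∧ˡ (suc n) b f =
  trans (cong ((b ∧ f zero) xor_) (sumF-∧ˡ n b (λ i → f (suc i))))
        (sym (∧-distribˡ-xor b _ _))

sumF-∧ʳ : ∀ n b (f : Fin n → Bool) → sumF n (λ i → f i ∧ b) ≡ sumF n f ∧ b
sumF-∧ʳ n b f = begin
  sumF n (λ i → f i ∧ b)  ≡⟨ sumF-cong n (λ i → ∧-comm (f i) b) ⟩
  sumF n (λ i → b ∧ f i)  ≡⟨ sumF-∧ˡ n b f ⟩
  b ∧ sumF n f            ≡⟨ ∧-comm b _ ⟩
  sumF n f ∧ b            ∎

sumF-swap : ∀ n k (f : Fin n → Fin k → Bool) →
  sumF n (λ i → sumF k (f i)) ≡ sumF k (λ j → sumF n (λ i → f i j))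
sumF-swap zero    k f = sym (sumF-zero k)
sumF-swap (suc n) k f = begin
  sumF k (f zero) xor sumF n (λ i → sumF k (f (suc i)))
    ≡⟨ cong (sumF k (f zero) xor_) (sumF-swap n k (λ i → f (suc i))) ⟩
  sumF k (f zero) xor sumF k (λ j → sumF n (λ i → f (suc i) j))
    ≡⟨ sym (sumF-xor k _ _) ⟩
  sumF k (λ j → sumF (suc n) (λ i → f i j)) ∎

sumF-delta : ∀ n (f : Fin n → Bool) k → sumF n (λ j → f j ∧ ⌊ j ≟ k ⌋) ≡ f k
sumF-delta (suc n) f zero = begin
  f zero ∧ true xor sumF n (λ j → f (suc j) ∧ false)
    ≡⟨ cong₂ _xor_ (∧-identityʳ (f zero))
                   (trans (sumF-cong n (λ j → ∧-zeroʳ (f (suc j)))) (sumF-zero n)) ⟩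
  f zero xor false
    ≡⟨ xor-identityʳ (f zero) ⟩
  f zero ∎
sumF-delta (suc n) f (suc k) = begin
  f zero ∧ false xor sumF n (λ j → f (suc j) ∧ ⌊ suc j ≟ suc k ⌋)
    ≡⟨ cong₂ _xor_ (∧-zeroʳ (f zero)) (sumF-cong n (λ j → cong (f (suc j) ∧_) (≟-suc j k))) ⟩
  sumF n (λ j → f (suc j) ∧ ⌊ j ≟ k ⌋)
    ≡⟨ sumF-delta n (λ j → f (suc j)) k ⟩
  f (suc k) ∎

sumF-split : ∀ m k (f : Fin (m + k) → Bool) →
  sumF (m + k) f ≡ sumF m (λ i → f (i ↑ˡ k)) xor sumF k (λ i → f (m ↑ʳ i))
sumF-split zero    k f = refl
sumF-split (suc m) k f =
  trans (cong (f zero xor_) (sumF-split m k (λ i → f (suc i)))) (sym (xor-assoc (f zero) _ _))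

-- A symmetric double sum with vanishing diagonal is zero: the off-diagonal
-- terms cancel in pairs.
sumF-alternating : ∀ n (f : Fin n → Fin n → Bool) →
  (∀ i j → f i j ≡ f j i) → (∀ i → f i i ≡ false) → sumF n (λ i → sumF n (f i)) ≡ false
sumF-alternating zero    f symm diag = refl
sumF-alternating (suc n) f symm diag = begin
  (f zero zero xor row) xor sumF n (λ i → f (suc i) zero xor sumF n (λ j → f (suc i) (suc j)))
    ≡⟨ cong₂ _xor_ (cong (_xor row) (diag zero)) (sumF-xor n _ _) ⟩
  row xor (sumF n (λ i → f (suc i) zero) xor sumF n (λ i → sumF n (λ j → f (suc i) (suc j))))
    ≡⟨ cong (row xor_) (cong₂ _xor_ column≡row
         (sumF-alternating n (λ i j → f (suc i) (suc j))
                           (λ i j → symm (suc i) (suc j)) (λ i → diag (suc i)))) ⟩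
  row xor (row xor false)
    ≡⟨ trans (cong (row xor_) (xor-identityʳ row)) (xor-same row) ⟩
  false ∎
  where
  row = sumF n (λ j → f zero (suc j))
  column≡row : sumF n (λ i → f (suc i) zero) ≡ row
  column≡row = sumF-cong n (λ i → symm (suc i) zero)

_⊕_ : ∀ {n} → Vector n → Vector n → Vector n
(u ⊕ v) i = u i xor v i

0V : ∀ {n} → Vector n
0V i = false

e : ∀ {n} → Fin n → Vector n
e k j = ⌊ j ≟ k ⌋

Respects≈V : ∀ {n} → (Vector n → Set) → Set
Respects≈V P = ∀ {u v} → u ≈V v → P u → P v

apply-cong : ∀ {r c} (M : Matrix r c) {u v : Vector c} → u ≈V v → apply M u ≈V apply M v
apply-cong {c = c} M u≈v i = sumF-cong c (λ j → cong (M i j ∧_) (u≈v j))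

apply-congM : ∀ {r c} {M M′ : Matrix r c} → M ≈M M′ → ∀ v → apply M v ≈V apply M′ v
apply-congM {c = c} M≈M′ v i = sumF-cong c (λ j → cong (_∧ v j) (M≈M′ i j))

apply-xor : ∀ {r c} (M : Matrix r c) (u v : Vector c) → apply M (u ⊕ v) ≈V (apply M u ⊕ apply M v)
apply-xor {c = c} M u v i = trans (sumF-cong c (λ j → ∧-distribˡ-xor (M i j) (u j) (v j))) (sumF-xor c _ _)

apply-0V : ∀ {r c} (M : Matrix r c) → apply M 0V ≈V 0V
apply-0V {c = c} M i = trans (sumF-cong c (λ j → ∧-zeroʳ (M i j))) (sumF-zero c)

apply-zeroM : ∀ {r c} (v : Vector c) → apply (zeroM {r}) v ≈V 0V
apply-zeroM {c = c} v i = sumF-zero c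

apply-*M : ∀ {a b c} (A : Matrix a b) (B : Matrix b c) v → apply (A *M B) v ≈V apply A (apply B v)
apply-*M {b = b} {c = c} A B v i = begin
  sumF c (λ k → sumF b (λ j → A i j ∧ B j k) ∧ v k)
    ≡⟨ sumF-cong c (λ k → sym (sumF-∧ʳ b (v k) (λ j → A i j ∧ B j k))) ⟩
  sumF c (λ k → sumF b (λ j → (A i j ∧ B j k) ∧ v k))
    ≡⟨ sym (sumF-swap b c (λ j k → (A i j ∧ B j k) ∧ v k)) ⟩
  sumF b (λ j → sumF c (λ k → (A i j ∧ B j k) ∧ v k))
    ≡⟨ sumF-cong b (λ j → trans (sumF-cong c (λ k → ∧-assoc (A i j) (B j k) (v k)))
                                 (sumF-∧ˡ c (A i j) (λ k → B j k ∧ v k))) ⟩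
  sumF b (λ j → A i j ∧ sumF c (λ k → B j k ∧ v k)) ∎

apply-idM : ∀ {n} (v : Vector n) → apply (idM n) v ≈V v
apply-idM {n} v i =
  trans (sumF-cong n (λ j → trans (∧-comm ⌊ i ≟ j ⌋ (v j)) (cong (v j ∧_) (≟-sym i j))))
        (sumF-delta n v i)

apply-e : ∀ {r c} (M : Matrix r c) k i → apply M (e k) i ≡ M i k
apply-e {c = c} M k i = sumF-delta c (M i) k

matrix-ext : ∀ {r c} {X Y : Matrix r c} → (∀ v → apply X v ≈V apply Y v) → X ≈M Y
matrix-ext {X = X} {Y} X≗Y i k = trans (sym (apply-e X k i)) (trans (X≗Y (e k) i) (apply-e Y k i))

dot-cong : ∀ {n} {u u′ v v′ : Vector n} → u ≈V u′ → v ≈V v′ → dot u v ≡ dot u′ v′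
dot-cong {n} u≈u′ v≈v′ = sumF-cong n (λ i → cong₂ _∧_ (u≈u′ i) (v≈v′ i))

dot-comm : ∀ {n} (u v : Vector n) → dot u v ≡ dot v u
dot-comm {n} u v = sumF-cong n (λ i → ∧-comm (u i) (v i))

dot-xorˡ : ∀ {n} (u u′ w : Vector n) → dot (u ⊕ u′) w ≡ dot u w xor dot u′ w
dot-xorˡ {n} u u′ w = trans (sumF-cong n (λ i → ∧-distribʳ-xor (w i) (u i) (u′ i))) (sumF-xor n _ _)

dot-0Vˡ : ∀ {n} (w : Vector n) → dot 0V w ≡ false
dot-0Vˡ {n} w = sumF-zero n

dot-e : ∀ {n} k (v : Vector n) → dot (e k) v ≡ v k
dot-e {n} k v = trans (sumF-cong n (λ j → ∧-comm ⌊ j ≟ k ⌋ (v j))) (sumF-delta n v k)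

dot-transpose : ∀ {n k} (A : Matrix k n) (x : Vector n) (w : Vector k) →
  dot x (apply (transpose A) w) ≡ dot (apply A x) w
dot-transpose {n} {k} A x w = begin
  sumF n (λ i → x i ∧ sumF k (λ j → A j i ∧ w j))
    ≡⟨ sumF-cong n (λ i → sym (sumF-∧ˡ k (x i) (λ j → A j i ∧ w j))) ⟩
  sumF n (λ i → sumF k (λ j → x i ∧ (A j i ∧ w j)))
    ≡⟨ sumF-swap n k _ ⟩
  sumF k (λ j → sumF n (λ i → x i ∧ (A j i ∧ w j)))
    ≡⟨ sumF-cong k (λ j → trans (sumF-cong n (λ i → regroup (x i) (A j i) (w j)))
                                 (sumF-∧ʳ n (w j) (λ i → A j i ∧ x i))) ⟩
  sumF k (λ j → sumF n (λ i → A j i ∧ x i) ∧ w j) ∎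
  where
  regroup : ∀ a b c → a ∧ (b ∧ c) ≡ (b ∧ a) ∧ c
  regroup a b c = trans (sym (∧-assoc a b c)) (cong (_∧ c) (∧-comm a b))

dot-separates : ∀ {n} {u v : Vector n} → (∀ x → dot x u ≡ dot x v) → u ≈V v
dot-separates {u = u} {v} same i = trans (sym (dot-e i u)) (trans (same (e i)) (dot-e i v))

IsLeftInverse : ∀ {r c} → Matrix r c → Matrix c r → Set
IsLeftInverse {r} X Y = ∀ (v : Vector r) → apply X (apply Y v) ≈V v

product⇒left-inverse : ∀ {r c} (X : Matrix r c) (Y : Matrix c r) →
  (X *M Y) ≈M idM r → IsLeftInverse X Y
product⇒left-inverse X Y XY≈I v i =
  trans (sym (apply-*M X Y v i)) (trans (apply-congM XY≈I v i) (apply-idM v i))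

left-inverse⇒product : ∀ {r c} (X : Matrix r c) (Y : Matrix c r) →
  IsLeftInverse X Y → (X *M Y) ≈M idM r
left-inverse⇒product X Y X∘Y≗id =
  matrix-ext (λ v i → trans (apply-*M X Y v i) (trans (X∘Y≗id v i) (sym (apply-idM v i))))

left-inverse-of-surjection : ∀ {r c} {L : Matrix c r} {A : Matrix r c} →
  IsLeftInverse L A → (∀ w → ∃ λ x → apply A x ≈V w) → IsLeftInverse A L
left-inverse-of-surjection {L = L} {A} LA surj w i with surj w
... | x , Ax≈w = begin
  apply A (apply L w) i           ≡⟨ apply-cong A (apply-cong L (λ k → sym (Ax≈w k))) i ⟩
  apply A (apply L (apply A x)) i ≡⟨ apply-cong A (LA x) i ⟩
  apply A x i                     ≡⟨ Ax≈w i ⟩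
  w i                             ∎

transpose-left-inverse : ∀ {r c} (X : Matrix r c) (Y : Matrix c r) →
  IsLeftInverse X Y → IsLeftInverse (transpose Y) (transpose X)
transpose-left-inverse X Y X∘Y≗id z = dot-separates λ x → begin
  dot x (apply (transpose Y) (apply (transpose X) z)) ≡⟨ dot-transpose Y x _ ⟩
  dot (apply Y x) (apply (transpose X) z)             ≡⟨ dot-transpose X (apply Y x) z ⟩
  dot (apply X (apply Y x)) z                         ≡⟨ dot-cong (X∘Y≗id x) (λ _ → refl) ⟩
  dot x z                                             ∎

left-inverse⇒trivial-kernel : ∀ {r c} {L : Matrix c r} {Y : Matrix r c} →
  IsLeftInverse L Y → ∀ x → apply Y x ≈V 0V → x ≈V 0V
left-inverse⇒trivial-kernel {L = L} {Y} LY x Yx≈0 i =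
  trans (sym (LY x i)) (trans (apply-cong L Yx≈0 i) (apply-0V L i))

alternating⇒isotropic : ∀ {n} (S : Matrix n n) → Symmetric S → ZeroDiag S →
  ∀ x → dot x (apply S x) ≡ false
alternating⇒isotropic {n} S sym-S diag-S x = begin
  dot x (apply S x)
    ≡⟨ sumF-cong n (λ i → sym (sumF-∧ˡ n (x i) (λ j → S i j ∧ x j))) ⟩
  sumF n (λ i → sumF n (λ j → x i ∧ (S i j ∧ x j)))
    ≡⟨ sumF-alternating n _ symm diag ⟩
  false ∎
  where
  symm : ∀ i j → x i ∧ (S i j ∧ x j) ≡ x j ∧ (S j i ∧ x i)
  symm i j = trans (∧-swap-outer (x i) (S i j) (x j)) (cong (λ s → x j ∧ (s ∧ x i)) (sym-S i j))
  diag : ∀ i → x i ∧ (S i i ∧ x i) ≡ false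
  diag i = trans (cong (λ s → x i ∧ (s ∧ x i)) (diag-S i)) (∧-zeroʳ (x i))

isotropic⇒alternating : ∀ {n} (S : Matrix n n) → (∀ x → dot x (apply S x) ≡ false) →
  Symmetric S × ZeroDiag S
isotropic⇒alternating S iso = symm , diag
  where
  diag : ZeroDiag S
  diag i = trans (sym (trans (dot-e i _) (apply-e S i i))) (iso (e i))

  -- Expanding  (eᵢ + eⱼ)·S(eᵢ + eⱼ) = 0  leaves  Sᵢⱼ + Sⱼᵢ = 0.
  symm : Symmetric S
  symm i j = xor-false⇒≡ (begin
    S i j xor S j i
      ≡⟨ cong (S i j xor_) (sym (xor-identityʳ (S j i))) ⟩
    S i j xor (S j i xor false)
      ≡⟨ sym (cong₂ (λ a b → (a xor S i j) xor (S j i xor b)) (diag i) (diag j)) ⟩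
    (S i i xor S i j) xor (S j i xor S j j)
      ≡⟨ sym (cong₂ _xor_ (entry i) (entry j)) ⟩
    w i xor w j
      ≡⟨ sym (cong₂ _xor_ (dot-e i w) (dot-e j w)) ⟩
    dot (e i) w xor dot (e j) w
      ≡⟨ sym (dot-xorˡ (e i) (e j) w) ⟩
    dot (e i ⊕ e j) w
      ≡⟨ iso (e i ⊕ e j) ⟩
    false ∎)
    where
    w = apply S (e i ⊕ e j)
    entry : ∀ k → w k ≡ S k i xor S k j
    entry k = trans (apply-xor S (e i) (e j) k) (cong₂ _xor_ (apply-e S i k) (apply-e S j k))

top-++ : ∀ {m} (x y : Vector m) → top {m} (x ++ y) ≈V x
top-++ x y = lookup-++ˡ x y

bot-++ : ∀ {m} (x y : Vector m) → bot {m} (x ++ y) ≈V y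
bot-++ x y = lookup-++ʳ x y

halves-ext : ∀ {m} (u v : Vector (m + m)) → top {m} u ≈V top v → bot {m} u ≈V bot v → u ≈V v
halves-ext {m} u v tops bots k with splitAt m k in eq
... | inj₁ i = subst (λ z → u z ≡ v z) (splitAt⁻¹-↑ˡ eq) (tops i)
... | inj₂ i = subst (λ z → u z ≡ v z) (splitAt⁻¹-↑ʳ eq) (bots i)

halves-matrix-ext : ∀ {m} {M M′ : Matrix (m + m) (m + m)} →
  (∀ v → top {m} (apply M v) ≈V top (apply M′ v)) →
  (∀ v → bot {m} (apply M v) ≈V bot (apply M′ v)) → M ≈M M′
halves-matrix-ext {M = M} {M′} tops bots =
  matrix-ext (λ v → halves-ext (apply M v) (apply M′ v) (tops v) (bots v))

topLeft topRight botLeft botRight : ∀ {m} → Matrix (m + m) (m + m) → Matrix m m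
topLeft  {m} M i j = M (i ↑ˡ m) (j ↑ˡ m)
topRight {m} M i j = M (i ↑ˡ m) (m ↑ʳ j)
botLeft  {m} M i j = M (m ↑ʳ i) (j ↑ˡ m)
botRight {m} M i j = M (m ↑ʳ i) (m ↑ʳ j)

top-apply : ∀ {m} (M : Matrix (m + m) (m + m)) v →
  top {m} (apply M v) ≈V (apply (topLeft M) (top {m} v) ⊕ apply (topRight M) (bot {m} v))
top-apply {m} M v i = sumF-split m m _

bot-apply : ∀ {m} (M : Matrix (m + m) (m + m)) v →
  bot {m} (apply M v) ≈V (apply (botLeft M) (top {m} v) ⊕ apply (botRight M) (bot {m} v))
bot-apply {m} M v i = sumF-split m m _

module _ {m : ℕ} (A B C D : Matrix m m) where

  topLeft-block : topLeft (block A B C D) ≈M A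
  topLeft-block i j rewrite splitAt-↑ˡ m i m | splitAt-↑ˡ m j m = refl

  topRight-block : topRight (block A B C D) ≈M B
  topRight-block i j rewrite splitAt-↑ˡ m i m | splitAt-↑ʳ m m j = refl

  botLeft-block : botLeft (block A B C D) ≈M C
  botLeft-block i j rewrite splitAt-↑ʳ m m i | splitAt-↑ˡ m j m = refl

  botRight-block : botRight (block A B C D) ≈M D
  botRight-block i j rewrite splitAt-↑ʳ m m i | splitAt-↑ʳ m m j = refl

  top-apply-block : ∀ v →
    top {m} (apply (block A B C D) v) ≈V (apply A (top {m} v) ⊕ apply B (bot {m} v))
  top-apply-block v i = trans (top-apply (block A B C D) v i)
    (cong₂ _xor_ (apply-congM topLeft-block (top {m} v) i) (apply-congM topRight-block (bot {m} v) i))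

  bot-apply-block : ∀ v →
    bot {m} (apply (block A B C D) v) ≈V (apply C (top {m} v) ⊕ apply D (bot {m} v))
  bot-apply-block v i = trans (bot-apply (block A B C D) v i)
    (cong₂ _xor_ (apply-congM botLeft-block (top {m} v) i) (apply-congM botRight-block (bot {m} v) i))

bot-apply-triangular : ∀ {m} (A B D : Matrix m m) v →
  bot {m} (apply (block A B zeroM D) v) ≈V apply D (bot {m} v)
bot-apply-triangular {m} A B D v i =
  trans (bot-apply-block A B zeroM D v i) (cong (_xor apply D (bot {m} v) i) (apply-zeroM (top {m} v) i))

preserves-intro : ∀ {n} {M M⁻ : Matrix n n} {P : Vector n → Set} →
  Respects≈V P → IsLeftInverse M M⁻ → (∀ v → P (apply M v) ⇔ P v) → Preserves M P
preserves-intro {M = M} {M⁻} resp MM⁻ P-invariant w = mk⇔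
  (λ { (v , Pv , Mv≈w) → resp Mv≈w (Equivalence.from (P-invariant v) Pv) })
  (λ Pw → apply M⁻ w
        , Equivalence.to (P-invariant (apply M⁻ w)) (resp (λ i → sym (MM⁻ w i)) Pw)
        , MM⁻ w)

preserves-pointwise : ∀ {n} {M N : Matrix n n} {P : Vector n → Set} →
  Respects≈V P → IsLeftInverse N M → Preserves M P → ∀ v → P (apply M v) ⇔ P v
preserves-pointwise {M = M} {N} {P} resp NM M-preserves v =
  mk⇔ reflect (λ Pv → Equivalence.to (M-preserves (apply M v)) (v , Pv , λ _ → refl))
  where
  reflect : P (apply M v) → P v
  reflect PMv with Equivalence.from (M-preserves (apply M v)) PMv
  ... | u , Pu , Mu≈Mv = resp (λ i → trans (sym (NM u i)) (trans (apply-cong N Mu≈Mv i) (NM v i))) Pu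

quadForm : ∀ {m} → Vector (m + m) → Bool
quadForm {m} v = dot (top {m} v) (bot {m} v)

Qm-respects : ∀ m → Respects≈V (Qm m)
Qm-respects m u≈v qu = trans (sym (dot-cong (λ i → u≈v (i ↑ˡ m)) (λ i → u≈v (m ↑ʳ i)))) qu

Sm-respects : ∀ m → Respects≈V (Sm m)
Sm-respects m u≈v su i = trans (sym (u≈v (m ↑ʳ i))) (su i)

module BlockInHm {m : ℕ} (A D S N : Matrix m m)
  (NA : IsLeftInverse N A) (AN : IsLeftInverse A N)
  (AᵀD : IsLeftInverse (transpose A) D) (DAᵀ : IsLeftInverse D (transpose A))
  (S-isotropic : ∀ x → dot x (apply S x) ≡ false) where

  M M⁻ : Matrix (m + m) (m + m)
  M  = block A (A *M S) zeroM D
  M⁻ = block N (S *M transpose A) zeroM (transpose A)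

  M-top : ∀ v → top {m} (apply M v) ≈V apply A (top {m} v ⊕ apply S (bot {m} v))
  M-top v i = begin
    top {m} (apply M v) i
      ≡⟨ top-apply-block A (A *M S) zeroM D v i ⟩
    apply A (top {m} v) i xor apply (A *M S) (bot {m} v) i
      ≡⟨ cong (apply A (top {m} v) i xor_) (apply-*M A S (bot {m} v) i) ⟩
    apply A (top {m} v) i xor apply A (apply S (bot {m} v)) i
      ≡⟨ sym (apply-xor A _ _ i) ⟩
    apply A (top {m} v ⊕ apply S (bot {m} v)) i ∎

  M-bot : ∀ v → bot {m} (apply M v) ≈V apply D (bot {m} v)
  M-bot = bot-apply-triangular A (A *M S) D

  M⁻-top : ∀ w → top {m} (apply M⁻ w) ≈V (apply N (top {m} w) ⊕ apply S (apply (transpose A) (bot {m} w)))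
  M⁻-top w i = trans (top-apply-block N (S *M transpose A) zeroM (transpose A) w i)
    (cong (apply N (top {m} w) i xor_) (apply-*M S (transpose A) (bot {m} w) i))

  M⁻-bot : ∀ w → bot {m} (apply M⁻ w) ≈V apply (transpose A) (bot {m} w)
  M⁻-bot = bot-apply-triangular N (S *M transpose A) (transpose A)

  M∘M⁻ : IsLeftInverse M M⁻
  M∘M⁻ w = halves-ext _ w tops (λ i → trans (M-bot u i) (trans (apply-cong D (M⁻-bot w) i) (DAᵀ b i)))
    where
    t = top {m} w
    b = bot {m} w
    u = apply M⁻ w
    tops : top {m} (apply M u) ≈V t
    tops i = begin
      top {m} (apply M u) i
        ≡⟨ M-top u i ⟩
      apply A (top {m} u ⊕ apply S (bot {m} u)) i
        ≡⟨ apply-cong A (λ k → cong₂ _xor_ (M⁻-top w k) (apply-cong S (M⁻-bot w) k)) i ⟩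
      apply A ((apply N t ⊕ apply S (apply (transpose A) b)) ⊕ apply S (apply (transpose A) b)) i
        ≡⟨ apply-cong A (λ k → xor-cancelʳ (apply N t k) _) i ⟩
      apply A (apply N t) i
        ≡⟨ AN t i ⟩
      t i ∎

  M⁻∘M : IsLeftInverse M⁻ M
  M⁻∘M v = halves-ext _ v tops (λ i → trans (M⁻-bot u i) (Aᵀ-of-M-bot i))
    where
    t = top {m} v
    b = bot {m} v
    u = apply M v
    Aᵀ-of-M-bot : apply (transpose A) (bot {m} u) ≈V b
    Aᵀ-of-M-bot i = trans (apply-cong (transpose A) (M-bot v) i) (AᵀD b i)
    tops : top {m} (apply M⁻ u) ≈V t
    tops i = begin
      top {m} (apply M⁻ u) i
        ≡⟨ M⁻-top u i ⟩
      apply N (top {m} u) i xor apply S (apply (transpose A) (bot {m} u)) i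
        ≡⟨ cong₂ _xor_ (trans (apply-cong N (M-top v) i) (NA _ i)) (apply-cong S Aᵀ-of-M-bot i) ⟩
      (t i xor apply S b i) xor apply S b i
        ≡⟨ xor-cancelʳ (t i) _ ⟩
      t i ∎

  -- q(Mv) = (v₁ + Sv₂)·AᵀDv₂ = v₁·v₂ + Sv₂·v₂ = q(v).
  quadForm-invariant : ∀ v → quadForm {m} (apply M v) ≡ quadForm {m} v
  quadForm-invariant v = begin
    dot (top {m} (apply M v)) (bot {m} (apply M v))
      ≡⟨ dot-cong (M-top v) (M-bot v) ⟩
    dot (apply A (t ⊕ apply S b)) (apply D b)
      ≡⟨ sym (dot-transpose A _ _) ⟩
    dot (t ⊕ apply S b) (apply (transpose A) (apply D b))
      ≡⟨ dot-cong (λ _ → refl) (AᵀD b) ⟩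
    dot (t ⊕ apply S b) b
      ≡⟨ dot-xorˡ t (apply S b) b ⟩
    dot t b xor dot (apply S b) b
      ≡⟨ cong (dot t b xor_) (trans (dot-comm (apply S b) b) (S-isotropic b)) ⟩
    dot t b xor false
      ≡⟨ xor-identityʳ _ ⟩
    dot t b ∎
    where
    t = top {m} v
    b = bot {m} v

  Sm-invariant : ∀ v → Sm m (apply M v) ⇔ Sm m v
  Sm-invariant v = mk⇔
    (λ MvS → left-inverse⇒trivial-kernel AᵀD (bot {m} v) (λ i → trans (sym (M-bot v i)) (MvS i)))
    (λ vS i → trans (M-bot v i) (trans (apply-cong D vS i) (apply-0V D i)))

  M∈Hm : Hm m M
  M∈Hm = (M⁻ , left-inverse⇒product M M⁻ M∘M⁻ , left-inverse⇒product M⁻ M M⁻∘M)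
       , preserves-intro (Qm-respects m) M∘M⁻
           (λ v → mk⇔ (trans (sym (quadForm-invariant v))) (trans (quadForm-invariant v)))
       , preserves-intro (Sm-respects m) M∘M⁻ Sm-invariant

block-in-Hm : (m : ℕ) (A D S : Matrix m m) → Invertible A → IsInverse (transpose A) D →
  Symmetric S → ZeroDiag S → Hm m (block A (A *M S) zeroM D)
block-in-Hm m A D S (N , AN , NA) (AᵀD , DAᵀ) sym-S diag-S =
  BlockInHm.M∈Hm A D S N (product⇒left-inverse N A NA) (product⇒left-inverse A N AN)
    (product⇒left-inverse (transpose A) D AᵀD) (product⇒left-inverse D (transpose A) DAᵀ) (alternating⇒isotropic S sym-S diag-S)

module HmIsBlock {m : ℕ} (M N : Matrix (m + m) (m + m)) (NM : IsLeftInverse N M)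
  (Q-preserved : Preserves M (Qm m)) (S-preserved : Preserves M (Sm m)) where

  A B C D : Matrix m m
  A = topLeft M
  B = topRight M
  C = botLeft M
  D = botRight M

  -- M maps (x, 0) ∈ S_m into S_m, so Cx = 0.
  C-vanishes : ∀ x → apply C x ≈V 0V
  C-vanishes x i = begin
    apply C x i
      ≡⟨ sym (xor-identityʳ _) ⟩
    apply C x i xor false
      ≡⟨ cong₂ _xor_ (apply-cong C (λ k → sym (top-++ x 0V k)) i)
                     (sym (trans (apply-cong D (bot-++ x 0V) i) (apply-0V D i))) ⟩
    apply C (top {m} v) i xor apply D (bot {m} v) i
      ≡⟨ sym (bot-apply M v i) ⟩
    bot {m} (apply M v) i
      ≡⟨ Equivalence.to (S-preserved (apply M v)) (v , bot-++ x 0V , λ _ → refl) i ⟩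
    false ∎
    where
    v = x ++ 0V

  M-bot : ∀ v → bot {m} (apply M v) ≈V apply D (bot {m} v)
  M-bot v i = trans (bot-apply M v i) (cong (_xor apply D (bot {m} v) i) (C-vanishes (top {m} v) i))

  -- (w, 0) ∈ S_m is the image of some v ∈ S_m, and then A v₁ = w.
  A-surjective : ∀ w → ∃ λ x → apply A x ≈V w
  A-surjective w with Equivalence.from (S-preserved (w ++ 0V)) (bot-++ w 0V)
  ... | v , v∈S , Mv≈w0 = top {m} v , λ i → begin
    apply A (top {m} v) i
      ≡⟨ sym (xor-identityʳ _) ⟩
    apply A (top {m} v) i xor false
      ≡⟨ cong (apply A (top {m} v) i xor_) (sym (trans (apply-cong B v∈S i) (apply-0V B i))) ⟩
    apply A (top {m} v) i xor apply B (bot {m} v) i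
      ≡⟨ sym (top-apply M v i) ⟩
    top {m} (apply M v) i
      ≡⟨ Mv≈w0 (i ↑ˡ m) ⟩
    top {m} (w ++ 0V) i
      ≡⟨ top-++ w 0V i ⟩
    w i ∎

  quadForm-invariant : ∀ v → quadForm {m} (apply M v) ≡ quadForm {m} v
  quadForm-invariant v = ≡false-ext (Equivalence.to Q-pointwise) (Equivalence.from Q-pointwise)
    where
    Q-pointwise = preserves-pointwise (Qm-respects m) NM Q-preserved v

  -- q(M(x, y)) = q(x, y)  reads  (Ax + By)·Dy = x·y.
  form-on-halves : ∀ x y → dot (apply A x ⊕ apply B y) (apply D y) ≡ dot x y
  form-on-halves x y = begin
    dot (apply A x ⊕ apply B y) (apply D y)
      ≡⟨ sym (dot-cong Mv-top Mv-bot) ⟩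
    quadForm {m} (apply M v)
      ≡⟨ quadForm-invariant v ⟩
    quadForm {m} v
      ≡⟨ dot-cong (top-++ x y) (bot-++ x y) ⟩
    dot x y ∎
    where
    v = x ++ y
    Mv-top : top {m} (apply M v) ≈V (apply A x ⊕ apply B y)
    Mv-top i = trans (top-apply M v i)
      (cong₂ _xor_ (apply-cong A (top-++ x y) i) (apply-cong B (bot-++ x y) i))
    Mv-bot : bot {m} (apply M v) ≈V apply D y
    Mv-bot i = trans (M-bot v i) (apply-cong D (bot-++ x y) i)

  B-D-isotropic : ∀ y → dot (apply B y) (apply D y) ≡ false
  B-D-isotropic y = begin
    dot (apply B y) (apply D y)
      ≡⟨ dot-cong (λ i → cong (_xor apply B y i) (sym (apply-0V A i))) (λ _ → refl) ⟩
    dot (apply A 0V ⊕ apply B y) (apply D y)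
      ≡⟨ form-on-halves 0V y ⟩
    dot 0V y
      ≡⟨ dot-0Vˡ y ⟩
    false ∎

  A-D-adjoint : ∀ x y → dot (apply A x) (apply D y) ≡ dot x y
  A-D-adjoint x y = begin
    dot (apply A x) (apply D y)
      ≡⟨ sym (xor-identityʳ _) ⟩
    dot (apply A x) (apply D y) xor false
      ≡⟨ cong (dot (apply A x) (apply D y) xor_) (sym (B-D-isotropic y)) ⟩
    dot (apply A x) (apply D y) xor dot (apply B y) (apply D y)
      ≡⟨ sym (dot-xorˡ (apply A x) (apply B y) (apply D y)) ⟩
    dot (apply A x ⊕ apply B y) (apply D y)
      ≡⟨ form-on-halves x y ⟩
    dot x y ∎

  AᵀD : IsLeftInverse (transpose A) D
  AᵀD y = dot-separates (λ x → trans (dot-transpose A x (apply D y)) (A-D-adjoint x y))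

  DᵀA : IsLeftInverse (transpose D) A
  DᵀA = transpose-left-inverse (transpose A) D AᵀD

  ADᵀ : IsLeftInverse A (transpose D)
  ADᵀ = left-inverse-of-surjection DᵀA A-surjective

  DAᵀ : IsLeftInverse D (transpose A)
  DAᵀ = transpose-left-inverse A (transpose D) ADᵀ

  S : Matrix m m
  S = transpose D *M B

  S-isotropic : ∀ x → dot x (apply S x) ≡ false
  S-isotropic x = begin
    dot x (apply S x)                         ≡⟨ dot-cong (λ _ → refl) (apply-*M (transpose D) B x) ⟩
    dot x (apply (transpose D) (apply B x))   ≡⟨ dot-transpose D x (apply B x) ⟩
    dot (apply D x) (apply B x)               ≡⟨ dot-comm (apply D x) (apply B x) ⟩
    dot (apply B x) (apply D x)               ≡⟨ B-D-isotropic x ⟩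
    false                                     ∎

  S-alternating : Symmetric S × ZeroDiag S
  S-alternating = isotropic⇒alternating S S-isotropic

  AS-acts-as-B : ∀ y → apply (A *M S) y ≈V apply B y
  AS-acts-as-B y i = begin
    apply (A *M S) y i                             ≡⟨ apply-*M A S y i ⟩
    apply A (apply S y) i                          ≡⟨ apply-cong A (apply-*M (transpose D) B y) i ⟩
    apply A (apply (transpose D) (apply B y)) i    ≡⟨ ADᵀ (apply B y) i ⟩
    apply B y i                                    ∎

  M-is-block : M ≈M block A (A *M S) zeroM D
  M-is-block = halves-matrix-ext
    (λ v i → trans (top-apply M v i)
      (trans (cong (apply A (top {m} v) i xor_) (sym (AS-acts-as-B (bot {m} v) i)))
             (sym (top-apply-block A (A *M S) zeroM D v i))))
    (λ v i → trans (M-bot v i) (sym (bot-apply-triangular A (A *M S) D v i)))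

Hm-is-block : (m : ℕ) (M : Matrix (m + m) (m + m)) → Hm m M →
  ∃ λ (A : Matrix m m) → ∃ λ (D : Matrix m m) → ∃ λ (S : Matrix m m) →
    Invertible A × IsInverse (transpose A) D × Symmetric S × ZeroDiag S ×
    (M ≈M block A (A *M S) zeroM D)
Hm-is-block m M ((N , _ , NM) , Q-preserved , S-preserved) =
  A , D , S
    , (transpose D , left-inverse⇒product A (transpose D) ADᵀ
                   , left-inverse⇒product (transpose D) A DᵀA)
    , (left-inverse⇒product (transpose A) D AᵀD , left-inverse⇒product D (transpose A) DAᵀ)
    , proj₁ S-alternating , proj₂ S-alternating , M-is-block
  where
  open HmIsBlock M N (product⇒left-inverse N M NM) Q-preserved S-preserved

-- The theorem.
mainTheorem2 : (m : ℕ) → 1 ≤ m →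
    ((A D S : Matrix m m) → Invertible A → IsInverse (transpose A) D →
      Symmetric S → ZeroDiag S → Hm m (block A (A *M S) zeroM D))
    ×
    ((M : Matrix (m + m) (m + m)) → Hm m M →
      ∃ λ (A : Matrix m m) → ∃ λ (D : Matrix m m) → ∃ λ (S : Matrix m m) →
        Invertible A × IsInverse (transpose A) D × Symmetric S × ZeroDiag S ×
        (M ≈M block A (A *M S) zeroM D))
mainTheorem2 m _ = block-in-Hm m , Hm-is-block m
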